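{- The equality $\mathbf{ab}=\mathbf{cd}$ of words does not in general imply $\mathbf a:\mathbf b::_m\mathbf c:\mathbf d$: there exist an alphabet $A$ and words $\mathbf a,\mathbf b,\mathbf c,\mathbf d\in A^\ast$ with $\mathbf{ab}=\mathbf{cd}$ such that $\mathbf a:\mathbf b::_m\mathbf c:\mathbf d$ does not hold in $(A^\ast,\cdot,A^\ast)$.
   Context: $(A^\ast,\cdot,A^\ast)$ is the algebra of all words over $A$ (including the empty word $\varepsilon$) with concatenation and a constant symbol for every word. A justification is a pair of terms $s\to t$ with every variable of $t$ occurring in $s$; $\uparrow(\mathbf a\to\mathbf b)$ is the set of justifications with $\mathbf a=s(\mathbf o)$, $\mathbf b=t(\mathbf o)$ for some assignment $\mathbf o$ of words to the variables. $\uparrow^m(\mathbf a\to\mathbf b)$ keeps those whose terms contain only a single fixed variable $x$, occurring at most once on each side. $\uparrow^m(\mathbf a\to\mathbf b:\!\cdot\,\mathbf c\to\mathbf d):=\uparrow^m(\mathbf a\to\mathbf b)\cap\uparrow^m(\mathbf c\to\mathbf d)$; a monolinear justification is trivial if it lies in all such sets. $\mathbf a\to\mathbf b:\!\cdot_m\,\mathbf c\to\mathbf d$ holds iff either (a) $\uparrow^m(\mathbf a\to\mathbf b)\cup\uparrow^m(\mathbf c\to\mathbf d)$ consists only of trivial justifications, or (b) with $J_{\mathbf e}$ denoting $\uparrow^m(\mathbf a\to\mathbf b:\!\cdot\,\mathbf c\to\mathbf e)$ minus trivial justifications, $J_{\mathbf d}\neq\emptyset$ and $J_{\mathbf d}\subseteq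 J_{\mathbf d'}$ implies $J_{\mathbf d'}\subseteq J_{\mathbf d}$ for every word $\mathbf d'$. Then $\mathbf a:\mathbf b::_m\mathbf c:\mathbf d$ iff $\mathbf a\to\mathbf b:\!\cdot_m\,\mathbf c\to\mathbf d$, $\mathbf b\to\mathbf a:\!\cdot_m\,\mathbf d\to\mathbf c$, $\mathbf c\to\mathbf d:\!\cdot_m\,\mathbf a\to\mathbf b$, $\mathbf d\to\mathbf c:\!\cdot_m\,\mathbf b\to\mathbf a$ all hold. -}

module Defs where

open import Data.Nat using (ℕ; zero; suc; _+_; _≤_)
open import Data.List using (List; []; _∷_; _++_)
open import Data.Product using (Σ; _×_; _,_; ∃)
open import Data.Sum using (_⊎_)
open import Relation.Nullary using (¬_)
open import Relation.Binary.PropositionalEquality using (_≡_)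

module _ {A : Set} where

  Word : Set
  Word = List A

  -- Terms of the algebra (A*, ·, A*) in the single fixed variable x:
  -- the variable, a constant symbol for every word, and concatenation.
  data Term : Set where
    var  : Term
    con  : Word → Term
    _·_  : Term → Term → Term

  occ : Term → ℕ
  occ var     = 1
  occ (con w) = 0
  occ (s · t) = occ s + occ t

  eval : Term → Word → Word
  eval var     o = o
  eval (con w) o = w
  eval (s · t) o = eval s o ++ eval t o

  record Justification : Set where
    constructor _⇒_
    field
      lhs : Term
      rhs : Term

  Monolinear : Justification → Set
  Monolinear (s ⇒ t) = (occ s ≤ 1) × (occ t ≤ 1) × (1 ≤ occ t → 1 ≤ occ s)

  Up : Word → Word → Justification → Set
  Up a b j = Monolinear j × Σ Word (λ o → (eval (Justification.lhs j) o ≡ a)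
                                       × (eval (Justification.rhs j) o ≡ b))

  UpPair : Word → Word → Word → Word → Justification → Set
  UpPair a b c d j = Up a b j × Up c d j

  Trivial : Justification → Set
  Trivial j = ∀ a b c d → UpPair a b c d j

  J : Word → Word → Word → Word → Justification → Set
  J a b c e j = UpPair a b c e j × ¬ Trivial j

  _⊆J_ : (Justification → Set) → (Justification → Set) → Set
  P ⊆J Q = ∀ j → P j → Q j

  Arrow : Word → Word → Word → Word → Set
  Arrow a b c d =
      (∀ j → (Up a b j ⊎ Up c d j) → Trivial j)
    ⊎ ( (Σ Justification (J a b c d))
      × (∀ d' → J a b c d ⊆J J a b c d' → J a b c d' ⊆J J a b c d))

  Proportion : Word → Word → Word → Word → Set
  Proportion a b c d =
    Arrow a b c d × Arrow b a d c × Arrow c d a b × Arrow d c b a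

-- Every justification common to ↑^m(a → ε) and ↑^m(ε → d) has a right-hand side
-- that is either closed, forcing d = ε, or contains x, forcing both assignments
-- to be ε and hence a = ε (via the left-hand side). So for nonempty a and d the
-- set ↑^m(a → ε :· ε → d) is empty, while the constant justification a → ε is
-- nontrivial; neither clause of a → ε :·_m ε → d can hold, although a ε = ε a.
module Submission where

open import Defs
open import Data.Nat using (ℕ; zero; suc; _≤_; z≤n; s≤s)
open import Data.Nat.Properties using (m+n≡0⇒m≡0; m+n≡0⇒n≡0)
open import Data.Fin using (Fin)
import Data.Fin as Fin
open import Data.List using (List; _++_; []; _∷_)
open import Data.List.Properties using (++-conicalˡ; ++-conicalʳ)
open import Data.Product using (Σ; _×_; _,_)
open import Data.Sum using (inj₁; inj₂)
open import Relation.Nullary using (¬_)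
open import Relation.Binary.PropositionalEquality using (_≡_; _≢_; refl; sym; trans; cong₂; subst)

module _ {A : Set} where

  eval-closed : (t : Term {A}) → occ t ≡ 0 → ∀ o o' → eval t o ≡ eval t o'
  eval-closed (con w) _ o o' = refl
  eval-closed (s · u) closed o o' =
    cong₂ _++_ (eval-closed s (m+n≡0⇒m≡0 (occ s) closed) o o')
               (eval-closed u (m+n≡0⇒n≡0 (occ s) closed) o o')

  eval≡[]⇒assignment≡[] : (t : Term {A}) → 1 ≤ occ t → ∀ o → eval t o ≡ [] → o ≡ []
  eval≡[]⇒assignment≡[] var _ o e = e
  eval≡[]⇒assignment≡[] (s · u) open-t o e with occ s in occ-s
  ... | zero  = eval≡[]⇒assignment≡[] u open-t o (++-conicalʳ (eval s o) _ e)
  ... | suc _ = eval≡[]⇒assignment≡[] s (subst (1 ≤_) (sym occ-s) (s≤s z≤n)) o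
                  (++-conicalˡ _ _ e)

  ¬UpPair-erase-insert : {a d : Word {A}} → a ≢ [] → d ≢ [] → ∀ j → ¬ UpPair a [] [] d j
  ¬UpPair-erase-insert a≢[] d≢[] (s ⇒ t) (((_ , _ , x∈t⇒x∈s) , o₁ , s₁ , t₁) , (_ , o₂ , s₂ , t₂))
    with occ t in occ-t
  ... | zero = d≢[] (trans (sym t₂) (trans (eval-closed t occ-t o₂ o₁) t₁))
  ... | suc _
    with refl ← eval≡[]⇒assignment≡[] t (subst (1 ≤_) (sym occ-t) (s≤s z≤n)) o₁ t₁
       | refl ← eval≡[]⇒assignment≡[] s (x∈t⇒x∈s (s≤s z≤n)) o₂ s₂
       = a≢[] (trans (sym s₁) s₂)

  constant∈Up : (a b : Word {A}) → Up a b (con a ⇒ con b)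
  constant∈Up a b = (z≤n , z≤n , λ ()) , [] , refl , refl

  ¬Trivial-constant : {a b : Word {A}} → a ≢ [] → ¬ Trivial (con a ⇒ con b)
  ¬Trivial-constant a≢[] trivial with trivial [] [] [] []
  ... | (_ , _ , a≡[] , _) , _ = a≢[] a≡[]

  ¬Arrow-of-disjoint : {a b c d : Word {A}} → a ≢ [] → (∀ j → ¬ UpPair a b c d j) →
                       ¬ Arrow a b c d
  ¬Arrow-of-disjoint {a} {b} a≢[] _ (inj₁ allTrivial) =
    ¬Trivial-constant a≢[] (allTrivial (con a ⇒ con b) (inj₁ (constant∈Up a b)))
  ¬Arrow-of-disjoint _ disjoint (inj₂ ((j , j∈J , _) , _)) = disjoint j j∈J

mainTheorem14 : Σ ℕ λ n → Σ (List (Fin n)) λ a → Σ (List (Fin n)) λ b →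
    Σ (List (Fin n)) λ c → Σ (List (Fin n)) λ d →
    (a ++ b ≡ c ++ d) × ¬ Proportion a b c d
mainTheorem14 = 1 , letter , [] , [] , letter , refl , λ (arrow , _) →
  ¬Arrow-of-disjoint (λ ()) (¬UpPair-erase-insert (λ ()) (λ ())) arrow
  where
  letter : List (Fin 1)
  letter = Fin.zero ∷ []
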